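{- Let $n\geq1$. The map $g_n:R(\mathbb{Q}^n)\to SDG_{n+1}$ given by $g_n(G)=(A,A^+,u_A)$, where $A=G\oplus\mathbb{Q}$, $A^+=\{(h,q)\in G\oplus\mathbb{Q}: q>0\}\cup\{(0,0)\}$ and $u_A=(0,1)$, is a Borel reduction from $\cong_n$ to $\cong_{n+1}^+$.
   Context: $R(\mathbb{Q}^n)$ is the standard Borel space of subgroups of $\mathbb{Q}^n$ of rank $n$, and $\cong_n$ is the isomorphism relation on it (equivalently, $A\cong_nB$ iff $A=\varphi(B)$ for some $\varphi\in\mathrm{GL}_n(\mathbb{Q})$). $SDG_{n+1}$ is the standard Borel space of triples $(A,A^+,u)\in R(\mathbb{Q}^{n+1})\times\mathcal{P}(\mathbb{Q}^{n+1})\times\mathbb{Q}^{n+1}$ which are simple unital dimension groups (unperforated ordered abelian groups with Riesz interpolation and distinguished order unit $u$, simple meaning every nonzero positive element is an order unit), and $\cong_{n+1}^+$ is isomorphism of such (group isomorphisms preserving the positive cone and order unit). $G\oplus\mathbb{Q}$ is regarded as a subgroup of $\mathbb{Q}^{n+1}$. A Borel reduction from $E$ to $F$ is a Borel map $f$ with $xEy\iff f(x)Ff(y)$. -}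

module Defs where

open import Level using (0ℓ)
open import Data.Nat using (ℕ; zero; suc)
open import Data.Rational using (ℚ; 0ℚ; 1ℚ; _<_)
import Data.Rational as Q
open import Data.Vec using (Vec; []; _∷_; replicate; zipWith; map; foldr′; init; last; _∷ʳ_)
open import Data.Product using (Σ; ∃; ∃-syntax; _×_; _,_; proj₁)
open import Data.Sum using (_⊎_)
open import Data.Empty using (⊥)
open import Relation.Nullary using (¬_)
open import Relation.Unary using (Pred)
open import Relation.Binary.PropositionalEquality using (_≡_; _≢_)

V : ℕ → Set
V n = Vec ℚ n

0v : ∀ {n} → V n
0v {n} = replicate n 0ℚ

infixl 6 _+v_ _-v_
_+v_ : ∀ {n} → V n → V n → V n
_+v_ = zipWith Q._+_

negv : ∀ {n} → V n → V n
negv = map (λ q → Q.- q)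

_-v_ : ∀ {n} → V n → V n → V n
x -v y = x +v negv y

nmul : ∀ {n} → ℕ → V n → V n
nmul zero    x = 0v
nmul (suc k) x = x +v nmul k x

Sub : ℕ → Set₁
Sub n = Pred (V n) 0ℓ

_⇔_ : Set → Set → Set
P ⇔ Q' = (P → Q') × (Q' → P)

record IsSubgroup {n : ℕ} (S : Sub n) : Set where
  field
    has-0  : S 0v
    closed+ : ∀ x y → S x → S y → S (x +v y)
    closed- : ∀ x → S x → S (negv x)

-- rank n: S spans ℚ^n over ℚ, i.e. every vector has a nonzero
-- integer multiple in S
FullRank : ∀ {n} → Sub n → Set
FullRank S = ∀ x → ∃[ k ] S (nmul (suc k) x)

record RQ (n : ℕ) : Set₁ where
  field
    carrier    : Sub n
    isSubgroup : IsSubgroup carrier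
    fullRank   : FullRank carrier
open RQ public

Matrix : ℕ → Set
Matrix n = Vec (Vec ℚ n) n

dot : ∀ {n} → V n → V n → ℚ
dot r v = foldr′ Q._+_ 0ℚ (zipWith Q._*_ r v)

apply : ∀ {n} → Matrix n → V n → V n
apply M v = map (λ r → dot r v) M

IsInvertible : ∀ {n} → Matrix n → Set
IsInvertible {n} M = ∃[ N ] ((∀ v → apply M (apply N v) ≡ v) × (∀ v → apply N (apply M v) ≡ v))

_≅ₙ_ : ∀ {n} → RQ n → RQ n → Set
_≅ₙ_ {n} A B = ∃[ M ] (IsInvertible M ×
   (∀ x → carrier A x ⇔ (∃[ y ] (carrier B y × apply M y ≡ x))))

record Triple (m : ℕ) : Set₁ where
  constructor triple
  field
    grp  : Sub m
    pos  : Sub m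
    unit : V m
open Triple public

module _ {m : ℕ} (T : Triple m) where
  _≤T_ : V m → V m → Set
  x ≤T y = pos T (y -v x)

  IsOrderUnit : V m → Set
  IsOrderUnit w = pos T w × (∀ a → grp T a → ∃[ k ] ((negv (nmul k w) ≤T a) × (a ≤T nmul k w)))

  record IsSDG : Set where
    field
      grp-subgroup : IsSubgroup (grp T)
      grp-rank     : FullRank (grp T)
      pos⊆grp  : ∀ x → pos T x → grp T x
      pos-0    : pos T 0v
      pos-+    : ∀ x y → pos T x → pos T y → pos T (x +v y)
      pos-anti : ∀ x → pos T x → pos T (negv x) → x ≡ 0v
      unit-ou  : IsOrderUnit (unit T)
      unperf   : ∀ a k → grp T a → pos T (nmul (suc k) a) → pos T a
      riesz    : ∀ a₁ a₂ b₁ b₂ → grp T a₁ → grp T a₂ → grp T b₁ → grp T b₂ →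
                 a₁ ≤T b₁ → a₁ ≤T b₂ → a₂ ≤T b₁ → a₂ ≤T b₂ →
                 ∃[ c ] (grp T c × a₁ ≤T c × a₂ ≤T c × c ≤T b₁ × c ≤T b₂)
      simple   : ∀ a → pos T a → a ≢ 0v → IsOrderUnit a

Elt : ∀ {m} → Sub m → Set
Elt {m} S = Σ (V m) S

_≅⁺_ : ∀ {m} → Triple m → Triple m → Set
_≅⁺_ {m} T U =
  Σ (Elt (grp T) → Elt (grp U)) λ f → Σ (Elt (grp U) → Elt (grp T)) λ g →
    ( (∀ (a : Elt (grp T)) → proj₁ (g (f a)) ≡ proj₁ a)
    × (∀ (b : Elt (grp U)) → proj₁ (f (g b)) ≡ proj₁ b)
    × (∀ x y (px : grp T x) (py : grp T y) (pxy : grp T (x +v y)) →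
         proj₁ (f (x +v y , pxy)) ≡ proj₁ (f (x , px)) +v proj₁ (f (y , py)))
    × (∀ (a : Elt (grp T)) → pos T (proj₁ a) ⇔ pos U (proj₁ (f a)))
    × (∀ (pu : grp T (unit T)) → proj₁ (f (unit T , pu)) ≡ unit U) )

-- Borel structure on P(ℚ^n): σ-algebra generated by {S : x ∈ S}

data BorelCode (n : ℕ) : Set where
  basic : V n → BorelCode n
  compl : BorelCode n → BorelCode n
  union : (ℕ → BorelCode n) → BorelCode n

⟦_⟧ : ∀ {n} → BorelCode n → Sub n → Set
⟦ basic x ⟧ S = S x
⟦ compl c ⟧ S = ¬ ⟦ c ⟧ S
⟦ union c ⟧ S = ∃[ i ] ⟦ c i ⟧ S

IsBorelR : ∀ {n} → (RQ n → Set) → Set₁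
IsBorelR {n} P = ∃[ c ] (∀ (G : RQ n) → P G ⇔ ⟦ c ⟧ (carrier G))

-- a map R(ℚ^n) → P(ℚ^m) × P(ℚ^m) × ℚ^m is Borel iff the preimages of the
-- generating sets {x ∈ A}, {x ∈ A⁺}, {u = v} are Borel
IsBorelMap : ∀ {n m} → (RQ n → Triple m) → Set₁
IsBorelMap {n} {m} g =
    (∀ (x : V m) → IsBorelR (λ G → grp (g G) x))
  × (∀ (x : V m) → IsBorelR (λ G → pos (g G) x))
  × (∀ (v : V m) → IsBorelR (λ G → unit (g G) ≡ v))

-- The map g_n : G ↦ (G ⊕ ℚ, {(h,q) : q > 0} ∪ {0}, (0,1)),
-- with (h,q) ∈ ℚ^n ⊕ ℚ identified with h ∷ʳ q ∈ ℚ^(n+1)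

gA : ∀ {n} → RQ n → Sub (suc n)
gA G x = carrier G (init x)

gA⁺ : ∀ {n} → RQ n → Sub (suc n)
gA⁺ G x = (carrier G (init x) × 0ℚ < last x) ⊎ x ≡ 0v

gu : ∀ {n} → V (suc n)
gu {n} = 0v {n} ∷ʳ 1ℚ

gmap : ∀ {n} → RQ n → Triple (suc n)
gmap G = triple (gA G) (gA⁺ G) gu

IsBorelReduction : ∀ {n} → (RQ n → Triple (suc n)) → Set₁
IsBorelReduction {n} f =
    (∀ G → IsSDG (f G))
  × IsBorelMap f
  × (∀ G H → (G ≅ₙ H) ⇔ (f G ≅⁺ f H))

-- On A = G ⊕ ℚ the cone A⁺ only looks at the last coordinate: a ≤ b iff a = b or the last
-- coordinate of a is smaller. Hence interpolation, unperforation and simplicity all reduce to ℚ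
-- being a dense archimedean ordered field, and each generating set of the Borel structure pulls
-- back to a basic set {G : x ∈ G} or to a trivial one.
--
-- If G = M H with M ∈ GL_n(ℚ), then M⁻¹ ⊕ id is an isomorphism g_n(G) ≅ g_n(H). Conversely, an
-- order isomorphism f maps G ⊕ 0 onto H ⊕ 0, these being the elements x such that neither x nor
-- −x is strictly positive. Its restriction is an additive bijection G → H; since G has rank n it
-- extends to an additive, hence ℚ-linear, bijection of ℚⁿ, which is given by a matrix.

module Submission where

open import Defs

open import Level using (0ℓ)
open import Function using (_∘_)
open import Algebra.Bundles using (AbelianGroup; CommutativeMonoid)
open import Algebra.Structures using (IsAbelianGroup)
import Algebra.Properties.Group
open import Data.Empty using (⊥-elim)
open import Data.Product using (∃; ∃-syntax; _×_; _,_; proj₁; proj₂)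
open import Data.Sum using (_⊎_; inj₁; inj₂)
open import Data.Nat using (ℕ; zero; suc)
import Data.Nat as ℕ
import Data.Nat.Properties as ℕ
open import Data.Nat.Coprimality using (1-coprimeTo) renaming (sym to coprime-sym)
open import Data.Integer using (ℤ; +_; -[1+_])
import Data.Integer as ℤ
import Data.Integer.Properties as ℤ
open import Data.Integer.Solver using () renaming (module +-*-Solver to ℤ-Solver)
open import Data.Rational using (ℚ; mkℚ; 0ℚ; 1ℚ; ↥_; ↧ₙ_; _<_; _⊔_; _⊓_)
import Data.Rational as Q
import Data.Rational.Properties as QP
import Data.Rational.Unnormalised as U
import Data.Rational.Unnormalised.Properties as UP
open import Data.Vec using (Vec; []; _∷_; replicate; zipWith; map; init; last; _∷ʳ_; initLast)
import Data.Vec.Properties as Vec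
open import Relation.Nullary using (¬_; yes; no)
open import Relation.Binary.Definitions using (tri<; tri≈; tri>)
open import Relation.Binary.PropositionalEquality

module ℚ+ = Algebra.Properties.Group QP.+-0-group
open import Algebra.Properties.CommutativeSemigroup (CommutativeMonoid.commutativeSemigroup QP.+-0-commutativeMonoid)
  using (interchange)

fromℕ : ℕ → ℚ
fromℕ k = mkℚ (+ k) 0 (coprime-sym (1-coprimeTo k))

fromℕ-suc : ∀ k → fromℕ (suc k) ≡ 1ℚ Q.+ fromℕ k
fromℕ-suc k = QP.toℚᵘ-injective (UP.≃-trans (U.*≡* cross) (UP.≃-sym (QP.toℚᵘ-homo-+ 1ℚ (fromℕ k))))
  where
  cross : + suc k ℤ.* + 1 ≡ (+ 1 ℤ.* + 1 ℤ.+ + k ℤ.* + 1) ℤ.* + 1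
  cross = cong (ℤ._* + 1) (cong₂ ℤ._+_ (sym (ℤ.*-identityʳ (+ 1))) (sym (ℤ.*-identityʳ (+ k))))

fromℤ : ℤ → ℚ
fromℤ (+ k)     = fromℕ k
fromℤ -[1+ k ] = Q.- fromℕ (suc k)

denominator-clears : ∀ q → fromℕ (↧ₙ q) Q.* q ≡ fromℤ (↥ q)
denominator-clears q@(mkℚ z d _) =
  QP.toℚᵘ-injective (UP.≃-trans (QP.toℚᵘ-homo-* (fromℕ (suc d)) q) (U.*≡* (cross z)))
  where
  open ℤ-Solver
  cross : ∀ z → (+ suc d ℤ.* z) ℤ.* U.↧ Q.toℚᵘ (fromℤ z) ≡ U.↥ Q.toℚᵘ (fromℤ z) ℤ.* (+ 1 ℤ.* + suc d)
  cross (+ k)     = solve 2 (λ x y → (x :* y) :* con (+ 1) := y :* (con (+ 1) :* x)) refl (+ suc d) (+ k)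
  cross -[1+ k ] = solve 2 (λ x y → (x :* y) :* con (+ 1) := y :* (con (+ 1) :* x)) refl (+ suc d) -[1+ k ]

archimedean : ∀ q → ∃[ k ] q < fromℕ k
archimedean (mkℚ z d _) = suc ℤ.∣ z ∣ , Q.*<* (begin-strict
  z ℤ.* + 1           ≡⟨ ℤ.*-identityʳ z ⟩
  z                   ≤⟨ i≤∣i∣ z ⟩
  + ℤ.∣ z ∣            <⟨ ℤ.+<+ (ℕ.n<1+n _) ⟩
  + suc ℤ.∣ z ∣        ≤⟨ ℤ.+≤+ (ℕ.m≤m*n (suc ℤ.∣ z ∣) (suc d)) ⟩
  + suc ℤ.∣ z ∣ ℤ.* + suc d ∎)
  where
  open ℤ.≤-Reasoning
  i≤∣i∣ : ∀ i → i ℤ.≤ + ℤ.∣ i ∣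
  i≤∣i∣ (+ _)     = ℤ.≤-refl
  i≤∣i∣ -[1+ _ ] = ℤ.-≤+

archimedean-multiple : ∀ q w → 0ℚ < w → ∃[ k ] q < fromℕ k Q.* w
archimedean-multiple q w 0<w = k , subst (_< fromℕ k Q.* w) q/w*w≡q (QP.*-monoˡ-<-pos w q/w<k)
  where
  instance
    _ = Q.positive 0<w
    _ = Q.>-nonZero 0<w
  k = proj₁ (archimedean (q Q.* Q.1/ w))
  q/w<k = proj₂ (archimedean (q Q.* Q.1/ w))
  q/w*w≡q : q Q.* Q.1/ w Q.* w ≡ q
  q/w*w≡q = trans (QP.*-assoc q (Q.1/ w) w) (trans (cong (q Q.*_) (QP.*-inverseˡ w)) (QP.*-identityʳ q))

p<q⇒0<q-p : ∀ {p q} → p < q → 0ℚ < q Q.- p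
p<q⇒0<q-p {p} {q} p<q = subst (_< q Q.- p) (QP.+-inverseʳ p) (QP.+-monoˡ-< (Q.- p) p<q)

0<q-p⇒p<q : ∀ {p q} → 0ℚ < q Q.- p → p < q
0<q-p⇒p<q {p} {q} 0<q-p = subst₂ _<_ (QP.+-identityˡ p) q-p+p≡q (QP.+-monoˡ-< p 0<q-p)
  where
  q-p+p≡q : q Q.- p Q.+ p ≡ q
  q-p+p≡q = trans (QP.+-assoc q (Q.- p) p) (trans (cong (q Q.+_) (QP.+-inverseˡ p)) (QP.+-identityʳ q))

⊔<⊓ : ∀ {a₁ a₂ b₁ b₂} → a₁ < b₁ → a₁ < b₂ → a₂ < b₁ → a₂ < b₂ → a₁ ⊔ a₂ < b₁ ⊓ b₂
⊔<⊓ {a₁} {a₂} {b₁} {b₂} a₁<b₁ a₁<b₂ a₂<b₁ a₂<b₂ with QP.⊔-sel a₁ a₂ | QP.⊓-sel b₁ b₂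
... | inj₁ eq | inj₁ eq′ = subst₂ _<_ (sym eq) (sym eq′) a₁<b₁
... | inj₁ eq | inj₂ eq′ = subst₂ _<_ (sym eq) (sym eq′) a₁<b₂
... | inj₂ eq | inj₁ eq′ = subst₂ _<_ (sym eq) (sym eq′) a₂<b₁
... | inj₂ eq | inj₂ eq′ = subst₂ _<_ (sym eq) (sym eq′) a₂<b₂

∷ʳ-init-last : ∀ {A : Set} {n} (xs : Vec A (suc n)) → init xs ∷ʳ last xs ≡ xs
∷ʳ-init-last xs = sym (proj₂ (proj₂ (initLast xs)))

init-last-injective : ∀ {A : Set} {n} {xs ys : Vec A (suc n)} → init xs ≡ init ys → last xs ≡ last ys → xs ≡ ys
init-last-injective {xs = xs} {ys} init≡ last≡ =
  trans (sym (∷ʳ-init-last xs)) (trans (cong₂ _∷ʳ_ init≡ last≡) (∷ʳ-init-last ys))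

init-zipWith : ∀ {A B C : Set} {n} (f : A → B → C) (xs : Vec A (suc n)) ys →
               init (zipWith f xs ys) ≡ zipWith f (init xs) (init ys)
init-zipWith {n = zero}  f (x ∷ []) (y ∷ []) = refl
init-zipWith {n = suc n} f (x ∷ xs) (y ∷ ys) = cong (f x y ∷_) (init-zipWith f xs ys)

last-zipWith : ∀ {A B C : Set} {n} (f : A → B → C) (xs : Vec A (suc n)) ys →
               last (zipWith f xs ys) ≡ f (last xs) (last ys)
last-zipWith {n = zero}  f (x ∷ []) (y ∷ []) = refl
last-zipWith {n = suc n} f (x ∷ xs) (y ∷ ys) = last-zipWith f xs ys

last-map : ∀ {A B : Set} {n} (f : A → B) (xs : Vec A (suc n)) → last (map f xs) ≡ f (last xs)
last-map {n = zero}  f (x ∷ []) = refl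
last-map {n = suc n} f (x ∷ xs) = last-map f xs

last-replicate : ∀ {A : Set} n (x : A) → last (replicate (suc n) x) ≡ x
last-replicate zero    x = refl
last-replicate (suc n) x = last-replicate n x

+v-isAbelianGroup : ∀ n → IsAbelianGroup _≡_ (_+v_ {n}) 0v negv
+v-isAbelianGroup n = record
  { isGroup = record
    { isMonoid = record
      { isSemigroup = record
        { isMagma = record { isEquivalence = isEquivalence ; ∙-cong = cong₂ _+v_ }
        ; assoc   = Vec.zipWith-assoc QP.+-assoc
        }
      ; identity = Vec.zipWith-identityˡ QP.+-identityˡ , Vec.zipWith-identityʳ QP.+-identityʳ
      }
    ; inverse = Vec.zipWith-inverseˡ QP.+-inverseˡ , Vec.zipWith-inverseʳ QP.+-inverseʳ
    ; ⁻¹-cong = cong negv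
    }
  ; comm = Vec.zipWith-comm QP.+-comm
  }

+v-abelianGroup : ℕ → AbelianGroup 0ℓ 0ℓ
+v-abelianGroup n = record { isAbelianGroup = +v-isAbelianGroup n }

module +v {n : ℕ} where
  open AbelianGroup (+v-abelianGroup n) public
  open import Algebra.Properties.AbelianGroup (+v-abelianGroup n) public
  open import Algebra.Properties.CommutativeMonoid.Mult commutativeMonoid public

nmul≡× : ∀ {n} k (x : V n) → nmul k x ≡ k +v.× x
nmul≡× zero    x = refl
nmul≡× (suc k) x = cong (x +v_) (nmul≡× k x)

nmul-+v : ∀ {n} k (x y : V n) → nmul k (x +v y) ≡ nmul k x +v nmul k y
nmul-+v k x y = trans (nmul≡× k (x +v y)) (trans (+v.×-distrib-+ x y k) (sym (cong₂ _+v_ (nmul≡× k x) (nmul≡× k y))))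

nmul-nmul : ∀ {n} j k (x : V n) → nmul j (nmul k x) ≡ nmul (j ℕ.* k) x
nmul-nmul j k x = begin
  nmul j (nmul k x)   ≡⟨ trans (nmul≡× j (nmul k x)) (cong (j +v.×_) (nmul≡× k x)) ⟩
  j +v.× (k +v.× x)   ≡⟨ +v.×-assocˡ x j k ⟩
  (j ℕ.* k) +v.× x    ≡⟨ sym (nmul≡× (j ℕ.* k) x) ⟩
  nmul (j ℕ.* k) x    ∎
  where open ≡-Reasoning

nmul-comm : ∀ {n} j k (x : V n) → nmul j (nmul k x) ≡ nmul k (nmul j x)
nmul-comm j k x = trans (nmul-nmul j k x) (trans (cong (λ i → nmul i x) (ℕ.*-comm j k)) (sym (nmul-nmul k j x)))

infixr 7 _·v_
_·v_ : ∀ {n} → ℚ → V n → V n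
q ·v x = map (q Q.*_) x

·v-distribʳ : ∀ {n} p q (x : V n) → (p Q.+ q) ·v x ≡ p ·v x +v q ·v x
·v-distribʳ p q []      = refl
·v-distribʳ p q (a ∷ x) = cong₂ _∷_ (QP.*-distribʳ-+ a p q) (·v-distribʳ p q x)

·v-assoc : ∀ {n} p q (x : V n) → p ·v q ·v x ≡ (p Q.* q) ·v x
·v-assoc p q []      = refl
·v-assoc p q (a ∷ x) = cong₂ _∷_ (sym (QP.*-assoc p q a)) (·v-assoc p q x)

·v-identityˡ : ∀ {n} (x : V n) → 1ℚ ·v x ≡ x
·v-identityˡ []      = refl
·v-identityˡ (a ∷ x) = cong₂ _∷_ (QP.*-identityˡ a) (·v-identityˡ x)

·v-zeroˡ : ∀ {n} (x : V n) → 0ℚ ·v x ≡ 0v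
·v-zeroˡ []      = refl
·v-zeroˡ (a ∷ x) = cong₂ _∷_ (QP.*-zeroˡ a) (·v-zeroˡ x)

·v-zeroʳ : ∀ {n} q → q ·v 0v {n} ≡ 0v
·v-zeroʳ {zero}  q = refl
·v-zeroʳ {suc n} q = cong₂ _∷_ (QP.*-zeroʳ q) (·v-zeroʳ q)

·v-negˡ : ∀ {n} q (x : V n) → (Q.- q) ·v x ≡ negv (q ·v x)
·v-negˡ q []      = refl
·v-negˡ q (a ∷ x) = cong₂ _∷_ (sym (QP.neg-distribˡ-* q a)) (·v-negˡ q x)

nmul≡fromℕ·v : ∀ {n} k (x : V n) → nmul k x ≡ fromℕ k ·v x
nmul≡fromℕ·v zero    x = sym (·v-zeroˡ x)
nmul≡fromℕ·v (suc k) x = begin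
  x +v nmul k x                  ≡⟨ cong₂ _+v_ (sym (·v-identityˡ x)) (nmul≡fromℕ·v k x) ⟩
  1ℚ ·v x +v fromℕ k ·v x        ≡⟨ sym (·v-distribʳ 1ℚ (fromℕ k) x) ⟩
  (1ℚ Q.+ fromℕ k) ·v x          ≡⟨ cong (_·v x) (sym (fromℕ-suc k)) ⟩
  fromℕ (suc k) ·v x             ∎
  where open ≡-Reasoning

·v-inverseˡ : ∀ {n} q .{{_ : Q.NonZero q}} (x : V n) → (Q.1/ q) ·v q ·v x ≡ x
·v-inverseˡ q x = trans (·v-assoc (Q.1/ q) q x) (trans (cong (_·v x) (QP.*-inverseˡ q)) (·v-identityˡ x))

·v-inverseʳ : ∀ {n} q .{{_ : Q.NonZero q}} (x : V n) → q ·v (Q.1/ q) ·v x ≡ x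
·v-inverseʳ q x = trans (·v-assoc q (Q.1/ q) x) (trans (cong (_·v x) (QP.*-inverseʳ q)) (·v-identityˡ x))

nmul-cancel : ∀ {n} k {x y : V n} → nmul (suc k) x ≡ nmul (suc k) y → x ≡ y
nmul-cancel k {x} {y} eq = begin
  x                    ≡⟨ sym (·v-inverseˡ q x) ⟩
  (Q.1/ q) ·v q ·v x   ≡⟨ cong ((Q.1/ q) ·v_) q·x≡q·y ⟩
  (Q.1/ q) ·v q ·v y   ≡⟨ ·v-inverseˡ q y ⟩
  y                    ∎
  where
  open ≡-Reasoning
  q = fromℕ (suc k)
  q·x≡q·y : q ·v x ≡ q ·v y
  q·x≡q·y = trans (sym (nmul≡fromℕ·v (suc k) x)) (trans eq (nmul≡fromℕ·v (suc k) y))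

Additive : ∀ {m k} → (V m → V k) → Set
Additive Φ = ∀ x y → Φ (x +v y) ≡ Φ x +v Φ y

nmul-denominator : ∀ {n} q (x : V n) → nmul (↧ₙ q) (q ·v x) ≡ fromℤ (↥ q) ·v x
nmul-denominator q x =
  trans (nmul≡fromℕ·v (↧ₙ q) (q ·v x)) (trans (·v-assoc (fromℕ (↧ₙ q)) q x) (cong (_·v x) (denominator-clears q)))

module _ {m k} {Φ : V m → V k} (Φ-additive : Additive Φ) where

  additive-0v : Φ 0v ≡ 0v
  additive-0v = +v.identityʳ-unique (Φ 0v) (Φ 0v) (trans (sym (Φ-additive 0v 0v)) (cong Φ (+v.identityʳ 0v)))

  additive-negv : ∀ x → Φ (negv x) ≡ negv (Φ x)
  additive-negv x = +v.inverseʳ-unique (Φ x) (Φ (negv x))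
    (trans (sym (Φ-additive x (negv x))) (trans (cong Φ (+v.inverseʳ x)) additive-0v))

  additive-nmul : ∀ j x → Φ (nmul j x) ≡ nmul j (Φ x)
  additive-nmul zero    x = additive-0v
  additive-nmul (suc j) x = trans (Φ-additive x (nmul j x)) (cong (Φ x +v_) (additive-nmul j x))

  additive-fromℤ·v : ∀ z x → Φ (fromℤ z ·v x) ≡ fromℤ z ·v Φ x
  additive-fromℤ·v (+ j) x = begin
    Φ (fromℕ j ·v x)   ≡⟨ cong Φ (sym (nmul≡fromℕ·v j x)) ⟩
    Φ (nmul j x)       ≡⟨ additive-nmul j x ⟩
    nmul j (Φ x)       ≡⟨ nmul≡fromℕ·v j (Φ x) ⟩
    fromℕ j ·v Φ x     ∎
    where open ≡-Reasoning
  additive-fromℤ·v -[1+ j ] x = begin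
    Φ ((Q.- fromℕ (suc j)) ·v x)     ≡⟨ cong Φ (·v-negˡ (fromℕ (suc j)) x) ⟩
    Φ (negv (fromℕ (suc j) ·v x))    ≡⟨ additive-negv _ ⟩
    negv (Φ (fromℕ (suc j) ·v x))    ≡⟨ cong negv (additive-fromℤ·v (+ suc j) x) ⟩
    negv (fromℕ (suc j) ·v Φ x)      ≡⟨ sym (·v-negˡ (fromℕ (suc j)) (Φ x)) ⟩
    (Q.- fromℕ (suc j)) ·v Φ x       ∎
    where open ≡-Reasoning

  -- clearing the denominator of q reduces to integer scalars
  additive-·v : ∀ q x → Φ (q ·v x) ≡ q ·v Φ x
  additive-·v q@(mkℚ _ d _) x = nmul-cancel d (begin
    nmul (suc d) (Φ (q ·v x))     ≡⟨ sym (additive-nmul (suc d) (q ·v x)) ⟩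
    Φ (nmul (suc d) (q ·v x))     ≡⟨ cong Φ (nmul-denominator q x) ⟩
    Φ (fromℤ (↥ q) ·v x)          ≡⟨ additive-fromℤ·v (↥ q) x ⟩
    fromℤ (↥ q) ·v Φ x            ≡⟨ sym (nmul-denominator q (Φ x)) ⟩
    nmul (suc d) (q ·v Φ x)       ∎)
    where open ≡-Reasoning

apply′ : ∀ {m k} → Vec (Vec ℚ k) m → V k → V m
apply′ M v = map (λ r → dot r v) M

dot-+v : ∀ {k} (r x y : V k) → dot r (x +v y) ≡ dot r x Q.+ dot r y
dot-+v []      []      []      = sym (QP.+-identityˡ 0ℚ)
dot-+v (a ∷ r) (b ∷ x) (c ∷ y) = trans (cong₂ Q._+_ (QP.*-distribˡ-+ a b c) (dot-+v r x y))
  (interchange (a Q.* b) (a Q.* c) (dot r x) (dot r y))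

apply′-additive : ∀ {m k} (M : Vec (Vec ℚ k) m) → Additive (apply′ M)
apply′-additive []      x y = refl
apply′-additive (r ∷ M) x y = cong₂ _∷_ (dot-+v r x y) (apply′-additive M x y)

fromColumns : ∀ {m k} → Vec (V m) k → Vec (Vec ℚ k) m
fromColumns {m} []       = replicate m []
fromColumns     (c ∷ cs) = zipWith _∷_ c (fromColumns cs)

combination : ∀ {m k} → Vec (V m) k → V k → V m
combination []       []       = 0v
combination (c ∷ cs) (x ∷ xs) = x ·v c +v combination cs xs

apply′-fromColumns : ∀ {m k} (cs : Vec (V m) k) v → apply′ (fromColumns cs) v ≡ combination cs v
apply′-fromColumns {m} [] [] = Vec.map-replicate (λ r → dot r []) [] m
apply′-fromColumns (c ∷ cs) (x ∷ xs) = trans (apply′-∷ c (fromColumns cs)) (cong (x ·v c +v_) (apply′-fromColumns cs xs))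
  where
  apply′-∷ : ∀ {m} (c : V m) M → apply′ (zipWith _∷_ c M) (x ∷ xs) ≡ x ·v c +v apply′ M xs
  apply′-∷ []      []      = refl
  apply′-∷ (a ∷ c) (r ∷ M) = cong₂ _∷_ (cong (Q._+ dot r xs) (QP.*-comm a x)) (apply′-∷ c M)

basis : ∀ {k} → Vec (V k) k
basis {zero}  = []
basis {suc k} = (1ℚ ∷ 0v) ∷ map (0ℚ ∷_) basis

combination-basis : ∀ {k} (v : V k) → combination basis v ≡ v
combination-basis []       = refl
combination-basis (x ∷ xs) = trans (cong (x ·v (1ℚ ∷ 0v) +v_) (combination-0∷ basis xs))
  (cong₂ _∷_ (trans (QP.+-identityʳ _) (QP.*-identityʳ x))
             (trans (cong (_+v combination basis xs) (·v-zeroʳ x)) (trans (+v.identityˡ _) (combination-basis xs))))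
  where
  combination-0∷ : ∀ {m k} (cs : Vec (V m) k) xs → combination (map (0ℚ ∷_) cs) xs ≡ 0ℚ ∷ combination cs xs
  combination-0∷ []       []       = refl
  combination-0∷ (c ∷ cs) (y ∷ ys) = trans (cong (y ·v (0ℚ ∷ c) +v_) (combination-0∷ cs ys))
    (cong (_∷ y ·v c +v combination cs ys) (trans (QP.+-identityʳ _) (QP.*-zeroʳ y)))

additive-combination : ∀ {m k j} {Φ : V m → V k} → Additive Φ → (cs : Vec (V m) j) → ∀ v →
                       Φ (combination cs v) ≡ combination (map Φ cs) v
additive-combination Φ-additive []       []       = additive-0v Φ-additive
additive-combination Φ-additive (c ∷ cs) (x ∷ xs) = trans (Φ-additive (x ·v c) (combination cs xs))
  (cong₂ _+v_ (additive-·v Φ-additive x c) (additive-combination Φ-additive cs xs))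

matrixOf : ∀ {m k} → (V m → V k) → Vec (Vec ℚ m) k
matrixOf Φ = fromColumns (map Φ basis)

apply′-matrixOf : ∀ {m k} {Φ : V m → V k} → Additive Φ → ∀ v → apply′ (matrixOf Φ) v ≡ Φ v
apply′-matrixOf {Φ = Φ} Φ-additive v = begin
  apply′ (matrixOf Φ) v           ≡⟨ apply′-fromColumns (map Φ basis) v ⟩
  combination (map Φ basis) v     ≡⟨ sym (additive-combination Φ-additive basis v) ⟩
  Φ (combination basis v)         ≡⟨ cong Φ (combination-basis v) ⟩
  Φ v                             ∎
  where open ≡-Reasoning

additive-∘ : ∀ {m k j} {Φ : V k → V j} {Ψ : V m → V k} → Additive Φ → Additive Ψ → Additive (Φ ∘ Ψ)
additive-∘ {Φ = Φ} Φ-additive Ψ-additive x y = trans (cong Φ (Ψ-additive x y)) (Φ-additive _ _)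

additive-unique : ∀ {m k} {S : Sub m} {Φ Ψ : V m → V k} → FullRank S → Additive Φ → Additive Ψ →
                  (∀ x → S x → Φ x ≡ Ψ x) → ∀ v → Φ v ≡ Ψ v
additive-unique S-fullRank Φ-additive Ψ-additive agree v with S-fullRank v
... | c , p = nmul-cancel c
  (trans (sym (additive-nmul Φ-additive (suc c) v)) (trans (agree _ p) (additive-nmul Ψ-additive (suc c) v)))

module Subgroup {m} {S : Sub m} (S-subgroup : IsSubgroup S) where
  open IsSubgroup S-subgroup public

  closed-nmul : ∀ j x → S x → S (nmul j x)
  closed-nmul zero    x p = has-0
  closed-nmul (suc j) x p = closed+ x (nmul j x) p (closed-nmul j x p)

  closed-sub : ∀ x y → S x → S y → S (x -v y)
  closed-sub x y p q = closed+ x (negv y) p (closed- y q)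

  common-multiple : FullRank S → ∀ u v → ∃[ c ] (S (nmul (suc c) u) × S (nmul (suc c) v))
  common-multiple S-fullRank u v with S-fullRank u | S-fullRank v
  ... | i , pu | j , pv = j ℕ.+ i ℕ.* suc j ,
    subst S (trans (nmul-nmul (suc j) (suc i) u) (cong (λ l → nmul l u) (ℕ.*-comm (suc j) (suc i))))
      (closed-nmul (suc j) _ pu) ,
    subst S (nmul-nmul (suc i) (suc j) v) (closed-nmul (suc i) _ pv)

AdditiveOn : ∀ {m k} (S : Sub m) → (Elt S → V k) → Set
AdditiveOn S φ = ∀ x y (px : S x) (py : S y) (pxy : S (x +v y)) → φ (x +v y , pxy) ≡ φ (x , px) +v φ (y , py)

module AdditiveOn {m k} {S : Sub m} (S-subgroup : IsSubgroup S)
                  {φ : Elt S → V k} (φ-additive : AdditiveOn S φ) where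
  open Subgroup S-subgroup

  private
    transport : ∀ {x y} (e : x ≡ y) (p : S x) → φ (x , p) ≡ φ (y , subst S e p)
    transport refl p = refl

  -- S x need not be a proposition, but additivity against 0 forces φ to ignore the proof
  irrelevant : ∀ x (p q : S x) → φ (x , p) ≡ φ (x , q)
  irrelevant x p q = begin
    φ (x , p)                        ≡⟨ transport x≡x+0 p ⟩
    φ (x +v 0v , subst S x≡x+0 p)    ≡⟨ φ-additive x 0v p has-0 _ ⟩
    φ (x , p) +v φ (0v , has-0)      ≡⟨ sym (φ-additive x 0v p has-0 _) ⟩
    φ (x +v 0v , subst S x≡x+0 q)    ≡⟨ sym (transport x≡x+0 q) ⟩
    φ (x , q)                        ∎
    where
    open ≡-Reasoning
    x≡x+0 = sym (+v.identityʳ x)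

  cong-φ : ∀ {x y} → x ≡ y → (p : S x) (q : S y) → φ (x , p) ≡ φ (y , q)
  cong-φ refl = irrelevant _

  φ-0v : (p : S 0v) → φ (0v , p) ≡ 0v
  φ-0v p = +v.identityʳ-unique _ _
    (trans (sym (φ-additive 0v 0v p p (closed+ _ _ p p))) (cong-φ (+v.identityʳ 0v) _ p))

  φ-negv : ∀ x (p : S x) (q : S (negv x)) → φ (negv x , q) ≡ negv (φ (x , p))
  φ-negv x p q = +v.inverseʳ-unique _ _
    (trans (sym (φ-additive x (negv x) p q (closed+ _ _ p q))) (trans (cong-φ (+v.inverseʳ x) _ has-0) (φ-0v has-0)))

  φ-nmul : ∀ j x (p : S x) (q : S (nmul j x)) → φ (nmul j x , q) ≡ nmul j (φ (x , p))
  φ-nmul zero    x p q = φ-0v q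
  φ-nmul (suc j) x p q = trans (φ-additive x (nmul j x) p (closed-nmul j x p) q) (cong (φ (x , p) +v_) (φ-nmul j x p _))

module LinearExtension {m k} {S : Sub m} (S-subgroup : IsSubgroup S) (S-fullRank : FullRank S)
                       {φ : Elt S → V k} (φ-additive : AdditiveOn S φ) where
  open Subgroup S-subgroup
  open AdditiveOn S-subgroup φ-additive

  extension : V m → V k
  extension v = (Q.1/ fromℕ (suc c)) ·v φ (nmul (suc c) v , p)
    where
    c = proj₁ (S-fullRank v)
    p = proj₂ (S-fullRank v)

  extension-nmul : ∀ c v (p : S (nmul (suc c) v)) → nmul (suc c) (extension v) ≡ φ (nmul (suc c) v , p)
  extension-nmul c v p = nmul-cancel i (begin
    nmul (suc i) (nmul (suc c) (extension v))         ≡⟨ nmul-comm (suc i) (suc c) (extension v) ⟩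
    nmul (suc c) (nmul (suc i) (extension v))         ≡⟨ cong (nmul (suc c)) i·extension ⟩
    nmul (suc c) (φ (nmul (suc i) v , q))             ≡⟨ sym (φ-nmul (suc c) _ q _) ⟩
    φ (nmul (suc c) (nmul (suc i) v) , ci)            ≡⟨ cong-φ (nmul-comm (suc c) (suc i) v) ci ic ⟩
    φ (nmul (suc i) (nmul (suc c) v) , ic)            ≡⟨ φ-nmul (suc i) _ p ic ⟩
    nmul (suc i) (φ (nmul (suc c) v , p))             ∎)
    where
    open ≡-Reasoning
    i = proj₁ (S-fullRank v)
    q = proj₂ (S-fullRank v)
    ci = closed-nmul (suc c) _ q
    ic = closed-nmul (suc i) _ p
    i·extension : nmul (suc i) (extension v) ≡ φ (nmul (suc i) v , q)
    i·extension = trans (nmul≡fromℕ·v (suc i) _) (·v-inverseʳ (fromℕ (suc i)) _)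

  extension-extends : ∀ x (p : S x) → extension x ≡ φ (x , p)
  extension-extends x p = begin
    extension x                   ≡⟨ sym (+v.identityʳ _) ⟩
    nmul 1 (extension x)          ≡⟨ extension-nmul 0 x (closed-nmul 1 x p) ⟩
    φ (nmul 1 x , _)              ≡⟨ cong-φ (+v.identityʳ x) _ p ⟩
    φ (x , p)                     ∎
    where open ≡-Reasoning

  extension-additive : Additive extension
  extension-additive u v with common-multiple S-fullRank u v
  ... | c , pu , pv = nmul-cancel c (begin
    nmul (suc c) (extension (u +v v))                         ≡⟨ extension-nmul c (u +v v) puv ⟩
    φ (nmul (suc c) (u +v v) , puv)                           ≡⟨ cong-φ (nmul-+v (suc c) u v) puv _ ⟩
    φ (nmul (suc c) u +v nmul (suc c) v , closed+ _ _ pu pv)  ≡⟨ φ-additive _ _ pu pv _ ⟩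
    φ (nmul (suc c) u , pu) +v φ (nmul (suc c) v , pv)        ≡⟨ sym (cong₂ _+v_ (extension-nmul c u pu) (extension-nmul c v pv)) ⟩
    nmul (suc c) (extension u) +v nmul (suc c) (extension v)  ≡⟨ sym (nmul-+v (suc c) (extension u) (extension v)) ⟩
    nmul (suc c) (extension u +v extension v)                 ∎)
    where
    open ≡-Reasoning
    puv = subst S (sym (nmul-+v (suc c) u v)) (closed+ _ _ pu pv)

init-additive : ∀ {n} → Additive {suc n} init
init-additive = init-zipWith Q._+_

last-+v : ∀ {n} (x y : V (suc n)) → last (x +v y) ≡ last x Q.+ last y
last-+v = last-zipWith Q._+_

last-negv : ∀ {n} (x : V (suc n)) → last (negv x) ≡ Q.- last x
last-negv = last-map (λ q → Q.- q)

last-sub : ∀ {n} (x y : V (suc n)) → last (x -v y) ≡ last x Q.- last y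
last-sub x y = trans (last-+v x (negv y)) (cong (last x Q.+_) (last-negv y))

last-nmul : ∀ {n} k (x : V (suc n)) → last (nmul k x) ≡ fromℕ k Q.* last x
last-nmul k x = trans (cong last (nmul≡fromℕ·v k x)) (last-map (fromℕ k Q.*_) x)

module DimensionGroup {n : ℕ} (G : RQ n) where
  private
    module G = Subgroup (isSubgroup G)

  infix 4 _≼_
  _≼_ : V (suc n) → V (suc n) → Set
  _≼_ = _≤T_ (gmap G)

  A-subgroup : IsSubgroup (gA G)
  A-subgroup = record
    { has-0   = subst (carrier G) (sym (additive-0v init-additive)) G.has-0
    ; closed+ = λ x y p q → subst (carrier G) (sym (init-additive x y)) (G.closed+ _ _ p q)
    ; closed- = λ x p → subst (carrier G) (sym (additive-negv init-additive x)) (G.closed- _ p)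
    }

  module A = Subgroup A-subgroup

  A-fullRank : FullRank (gA G)
  A-fullRank x with fullRank G (init x)
  ... | k , p = k , subst (carrier G) (sym (additive-nmul init-additive (suc k) x)) p

  A⁺⊆A : ∀ x → gA⁺ G x → gA G x
  A⁺⊆A x (inj₁ (p , _)) = p
  A⁺⊆A x (inj₂ refl)    = A.has-0

  A⁺-+ : ∀ x y → gA⁺ G x → gA⁺ G y → gA⁺ G (x +v y)
  A⁺-+ x y (inj₂ refl) y⁺ = subst (gA⁺ G) (sym (+v.identityˡ y)) y⁺
  A⁺-+ x y x⁺ (inj₂ refl) = subst (gA⁺ G) (sym (+v.identityʳ x)) x⁺
  A⁺-+ x y (inj₁ (p , 0<x)) (inj₁ (q , 0<y)) =
    inj₁ (A.closed+ x y p q , subst (0ℚ <_) (sym (last-+v x y)) (QP.+-mono-< 0<x 0<y))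

  A⁺-last-zero : ∀ {x} → gA⁺ G x → last x ≡ 0ℚ → x ≡ 0v
  A⁺-last-zero (inj₁ (_ , 0<x)) x≡0 = ⊥-elim (QP.<-irrefl (sym x≡0) 0<x)
  A⁺-last-zero (inj₂ x≡0)       _   = x≡0

  A⁺-anti : ∀ x → gA⁺ G x → gA⁺ G (negv x) → x ≡ 0v
  A⁺-anti x (inj₂ x≡0) _ = x≡0
  A⁺-anti x (inj₁ _) (inj₂ -x≡0) = +v.⁻¹-injective (trans -x≡0 (sym +v.ε⁻¹≈ε))
  A⁺-anti x (inj₁ (_ , 0<x)) (inj₁ (_ , 0<-x)) =
    ⊥-elim (QP.<-irrefl refl (subst (0ℚ <_) (QP.+-inverseʳ (last x)) (QP.+-mono-< 0<x (subst (0ℚ <_) (last-negv x) 0<-x))))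

  ≼-refl : ∀ x → x ≼ x
  ≼-refl x = inj₂ (+v.inverseʳ x)

  ≼⇒≡⊎< : ∀ {x y} → x ≼ y → y ≡ x ⊎ last x < last y
  ≼⇒≡⊎< {x} {y} (inj₂ y-x≡0)     = inj₁ (+v.x∙y⁻¹≈ε⇒x≈y y x y-x≡0)
  ≼⇒≡⊎< {x} {y} (inj₁ (_ , 0<y-x)) = inj₂ (0<q-p⇒p<q (subst (0ℚ <_) (last-sub y x) 0<y-x))

  <⇒≼ : ∀ {x y} → gA G x → gA G y → last x < last y → x ≼ y
  <⇒≼ {x} {y} p q x<y = inj₁ (A.closed-sub y x q p , subst (0ℚ <_) (sym (last-sub y x)) (p<q⇒0<q-p x<y))

  orderUnit : ∀ w → gA G w → 0ℚ < last w → IsOrderUnit (gmap G) w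
  orderUnit w p 0<w = inj₁ (p , 0<w) , bounded
    where
    bounded : ∀ a → gA G a → ∃[ k ] (negv (nmul k w) ≼ a × a ≼ nmul k w)
    bounded a q with archimedean-multiple (last a ⊔ Q.- last a) (last w) 0<w
    ... | k , ∣a∣<kw = k , <⇒≼ (A.closed- _ kw∈A) q -kw<a , <⇒≼ q kw∈A a<kw
      where
      kw∈A = A.closed-nmul k w p
      a<kw : last a < last (nmul k w)
      a<kw = subst (last a <_) (sym (last-nmul k w)) (QP.≤-<-trans (QP.p≤p⊔q (last a) (Q.- last a)) ∣a∣<kw)
      -kw<a : last (negv (nmul k w)) < last a
      -kw<a = subst₂ _<_ (sym (trans (last-negv (nmul k w)) (cong (λ q → Q.- q) (last-nmul k w)))) (ℚ+.⁻¹-involutive (last a))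
                (QP.neg-antimono-< (QP.≤-<-trans (QP.p≤q⊔p (last a) (Q.- last a)) ∣a∣<kw))

  unperforated : ∀ a k → gA G a → gA⁺ G (nmul (suc k) a) → gA⁺ G a
  unperforated a k p (inj₁ (_ , 0<ka)) = inj₁ (p ,
    QP.*-cancelˡ-<-nonNeg (fromℕ (suc k)) (subst₂ _<_ (sym (QP.*-zeroʳ (fromℕ (suc k)))) (last-nmul (suc k) a) 0<ka))
  unperforated a k p (inj₂ ka≡0) = inj₂ (nmul-cancel k (trans ka≡0 (sym k0≡0)))
    where
    k0≡0 : nmul (suc k) 0v ≡ 0v
    k0≡0 = trans (nmul≡fromℕ·v (suc k) 0v) (·v-zeroʳ (fromℕ (suc k)))

  interpolate : ∀ {a₁ a₂ b₁ b₂} → gA G a₁ → gA G a₂ → gA G b₁ → gA G b₂ →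
                last a₁ < last b₁ → last a₁ < last b₂ → last a₂ < last b₁ → last a₂ < last b₂ →
                ∃[ c ] (gA G c × a₁ ≼ c × a₂ ≼ c × c ≼ b₁ × c ≼ b₂)
  interpolate {a₁} {a₂} {b₁} {b₂} p₁ p₂ q₁ q₂ a₁<b₁ a₁<b₂ a₂<b₁ a₂<b₂
    with QP.<-dense (⊔<⊓ a₁<b₁ a₁<b₂ a₂<b₁ a₂<b₂)
  ... | m , ⊔<m , m<⊓ = c , c∈A ,
      <⇒≼ p₁ c∈A (QP.≤-<-trans (QP.p≤p⊔q (last a₁) (last a₂)) a⊔<c) ,
      <⇒≼ p₂ c∈A (QP.≤-<-trans (QP.p≤q⊔p (last a₁) (last a₂)) a⊔<c) ,
      <⇒≼ c∈A q₁ (QP.<-≤-trans c<b⊓ (QP.p⊓q≤p (last b₁) (last b₂))) ,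
      <⇒≼ c∈A q₂ (QP.<-≤-trans c<b⊓ (QP.p⊓q≤q (last b₁) (last b₂)))
    where
    c = init a₁ ∷ʳ m
    c∈A : gA G c
    c∈A = subst (carrier G) (sym (Vec.init-∷ʳ m (init a₁))) p₁
    a⊔<c : last a₁ ⊔ last a₂ < last c
    a⊔<c = subst (_ <_) (sym (Vec.last-∷ʳ m (init a₁))) ⊔<m
    c<b⊓ : last c < last b₁ ⊓ last b₂
    c<b⊓ = subst (_< _) (sym (Vec.last-∷ʳ m (init a₁))) m<⊓

  riesz : ∀ a₁ a₂ b₁ b₂ → gA G a₁ → gA G a₂ → gA G b₁ → gA G b₂ →
          a₁ ≼ b₁ → a₁ ≼ b₂ → a₂ ≼ b₁ → a₂ ≼ b₂ →
          ∃[ c ] (gA G c × a₁ ≼ c × a₂ ≼ c × c ≼ b₁ × c ≼ b₂)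
  riesz a₁ a₂ b₁ b₂ p₁ p₂ q₁ q₂ a₁≼b₁ a₁≼b₂ a₂≼b₁ a₂≼b₂
    with ≼⇒≡⊎< a₁≼b₁ | ≼⇒≡⊎< a₁≼b₂ | ≼⇒≡⊎< a₂≼b₁ | ≼⇒≡⊎< a₂≼b₂
  ... | inj₁ refl | _         | _         | _         = a₁ , p₁ , ≼-refl a₁ , a₂≼b₁ , a₁≼b₁ , a₁≼b₂
  ... | inj₂ _    | inj₁ refl | _         | _         = a₁ , p₁ , ≼-refl a₁ , a₂≼b₂ , a₁≼b₁ , a₁≼b₂
  ... | inj₂ _    | inj₂ _    | inj₁ refl | _         = a₂ , p₂ , a₁≼b₁ , ≼-refl a₂ , a₂≼b₁ , a₂≼b₂
  ... | inj₂ _    | inj₂ _    | inj₂ _    | inj₁ refl = a₂ , p₂ , a₁≼b₂ , ≼-refl a₂ , a₂≼b₁ , a₂≼b₂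
  ... | inj₂ a₁<b₁ | inj₂ a₁<b₂ | inj₂ a₂<b₁ | inj₂ a₂<b₂ = interpolate p₁ p₂ q₁ q₂ a₁<b₁ a₁<b₂ a₂<b₁ a₂<b₂

  simple : ∀ a → gA⁺ G a → a ≢ 0v → IsOrderUnit (gmap G) a
  simple a (inj₁ (p , 0<a)) _   = orderUnit a p 0<a
  simple a (inj₂ a≡0)       a≢0 = ⊥-elim (a≢0 a≡0)

  u∈A : gA G gu
  u∈A = subst (carrier G) (sym (Vec.init-∷ʳ 1ℚ 0v)) G.has-0

  0<u : 0ℚ < last (gu {n})
  0<u = subst (0ℚ <_) (sym (Vec.last-∷ʳ 1ℚ (0v {n}))) (Q.*<* (ℤ.+<+ (ℕ.s≤s ℕ.z≤n)))

  isSDG : IsSDG (gmap G)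
  isSDG = record
    { grp-subgroup = A-subgroup
    ; grp-rank     = A-fullRank
    ; pos⊆grp      = A⁺⊆A
    ; pos-0        = inj₂ refl
    ; pos-+        = A⁺-+
    ; pos-anti     = A⁺-anti
    ; unit-ou      = orderUnit gu u∈A 0<u
    ; unperf       = unperforated
    ; riesz        = riesz
    ; simple       = simple
    }

-- every subgroup contains 0, so the generator {G : 0 ∈ G} is the whole space
borel-true : ∀ {n} {P : RQ n → Set} → (∀ G → P G) → IsBorelR P
borel-true P-holds = basic 0v , λ G → (λ _ → IsSubgroup.has-0 (isSubgroup G)) , (λ _ → P-holds G)

borel-false : ∀ {n} {P : RQ n → Set} → (∀ G → ¬ P G) → IsBorelR P
borel-false P-fails = compl (basic 0v) ,
  λ G → (λ p → ⊥-elim (P-fails G p)) , (λ 0∉G → ⊥-elim (0∉G (IsSubgroup.has-0 (isSubgroup G))))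

gmap-borel : ∀ {n} → IsBorelMap (gmap {n})
gmap-borel {n} = grp-borel , pos-borel , unit-borel
  where
  grp-borel : ∀ x → IsBorelR (λ G → gA G x)
  grp-borel x = basic (init x) , λ G → (λ p → p) , (λ p → p)

  pos-borel : ∀ x → IsBorelR (λ G → gA⁺ G x)
  pos-borel x with Vec.≡-dec QP._≟_ x 0v | 0ℚ Q.<? last x
  ... | yes x≡0 | _       = borel-true (λ G → inj₂ x≡0)
  ... | no x≢0  | yes 0<x = basic (init x) , λ G → from G , (λ p → inj₁ (p , 0<x))
    where
    from : ∀ G → gA⁺ G x → carrier G (init x)
    from G (inj₁ (p , _)) = p
    from G (inj₂ x≡0)     = ⊥-elim (x≢0 x≡0)
  ... | no x≢0  | no 0≮x  = borel-false not-positive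
    where
    not-positive : ∀ G → ¬ gA⁺ G x
    not-positive G (inj₁ (_ , 0<x)) = 0≮x 0<x
    not-positive G (inj₂ x≡0)       = x≢0 x≡0

  unit-borel : ∀ v → IsBorelR (λ G → unit (gmap G) ≡ v)
  unit-borel v with Vec.≡-dec QP._≟_ gu v
  ... | yes u≡v = borel-true (λ _ → u≡v)
  ... | no u≢v  = borel-false (λ _ → u≢v)

infixl 5 _⊕id
_⊕id : ∀ {m} → (V m → V m) → V (suc m) → V (suc m)
(φ ⊕id) x = φ (init x) ∷ʳ last x

init-⊕id : ∀ {m} (φ : V m → V m) x → init ((φ ⊕id) x) ≡ φ (init x)
init-⊕id φ x = Vec.init-∷ʳ (last x) (φ (init x))

last-⊕id : ∀ {m} (φ : V m → V m) x → last ((φ ⊕id) x) ≡ last x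
last-⊕id φ x = Vec.last-∷ʳ (last x) (φ (init x))

⊕id-additive : ∀ {m} {φ : V m → V m} → Additive φ → Additive (φ ⊕id)
⊕id-additive {φ = φ} φ-additive x y = init-last-injective
  (begin
    init ((φ ⊕id) (x +v y))                  ≡⟨ init-⊕id φ (x +v y) ⟩
    φ (init (x +v y))                        ≡⟨ cong φ (init-additive x y) ⟩
    φ (init x +v init y)                     ≡⟨ φ-additive (init x) (init y) ⟩
    φ (init x) +v φ (init y)                 ≡⟨ sym (cong₂ _+v_ (init-⊕id φ x) (init-⊕id φ y)) ⟩
    init ((φ ⊕id) x) +v init ((φ ⊕id) y)     ≡⟨ sym (init-additive ((φ ⊕id) x) ((φ ⊕id) y)) ⟩
    init ((φ ⊕id) x +v (φ ⊕id) y)            ∎)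
  (begin
    last ((φ ⊕id) (x +v y))                  ≡⟨ last-⊕id φ (x +v y) ⟩
    last (x +v y)                            ≡⟨ last-+v x y ⟩
    last x Q.+ last y                        ≡⟨ sym (cong₂ Q._+_ (last-⊕id φ x) (last-⊕id φ y)) ⟩
    last ((φ ⊕id) x) Q.+ last ((φ ⊕id) y)    ≡⟨ sym (last-+v ((φ ⊕id) x) ((φ ⊕id) y)) ⟩
    last ((φ ⊕id) x +v (φ ⊕id) y)            ∎)
  where open ≡-Reasoning

⊕id-inverse : ∀ {m} {φ ψ : V m → V m} → (∀ v → φ (ψ v) ≡ v) → ∀ x → (φ ⊕id) ((ψ ⊕id) x) ≡ x
⊕id-inverse {φ = φ} {ψ} φψ x = init-last-injective
  (trans (init-⊕id φ _) (trans (cong φ (init-⊕id ψ x)) (φψ (init x))))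
  (trans (last-⊕id φ _) (last-⊕id ψ x))

⊕id-positive : ∀ {m} {K L : RQ m} {φ : V m → V m} → Additive φ →
               ∀ x → gA L ((φ ⊕id) x) → gA⁺ K x → gA⁺ L ((φ ⊕id) x)
⊕id-positive {φ = φ} φ-additive x q (inj₁ (_ , 0<x)) = inj₁ (q , subst (0ℚ <_) (sym (last-⊕id φ x)) 0<x)
⊕id-positive         φ-additive x q (inj₂ refl)      = inj₂ (additive-0v (⊕id-additive φ-additive))

≅ₙ⇒≅⁺ : ∀ {m} {G H : RQ m} → G ≅ₙ H → gmap G ≅⁺ gmap H
≅ₙ⇒≅⁺ {m} {G} {H} (M , (N , MN , NM) , G≡MH) =
  f , g , (λ a → ⊕id-inverse {φ = apply M} {apply N} MN (proj₁ a)) , (λ b → ⊕id-inverse {φ = apply N} {apply M} NM (proj₁ b)) ,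
  (λ x y _ _ _ → ⊕id-additive (apply′-additive N) x y) , positive , (λ _ → unit-fixed)
  where
  N-maps : ∀ x → carrier G x → carrier H (apply N x)
  N-maps x p with proj₁ (G≡MH x) p
  ... | y , q , My≡x = subst (carrier H) (trans (sym (NM y)) (cong (apply N) My≡x)) q

  M-maps : ∀ y → carrier H y → carrier G (apply M y)
  M-maps y q = proj₂ (G≡MH _) (y , q , refl)

  lift : ∀ {K L : RQ m} (P : Matrix m) → (∀ x → carrier K x → carrier L (apply P x)) → Elt (gA K) → Elt (gA L)
  lift {L = L} P P-maps (x , p) = (apply P ⊕id) x , subst (carrier L) (sym (init-⊕id (apply P) x)) (P-maps _ p)

  f : Elt (gA G) → Elt (gA H)
  f = lift {G} {H} N N-maps

  g : Elt (gA H) → Elt (gA G)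
  g = lift {H} {G} M M-maps

  positive : ∀ a → gA⁺ G (proj₁ a) ⇔ gA⁺ H (proj₁ (f a))
  positive a@(x , _) =
    ⊕id-positive {K = G} {H} (apply′-additive N) x (proj₂ (f a)) ,
    λ fx⁺ → subst (gA⁺ G) (⊕id-inverse {φ = apply M} {apply N} MN x)
                  (⊕id-positive {K = H} {G} (apply′-additive M) _ (proj₂ (g (f a))) fx⁺)

  unit-fixed : (apply N ⊕id) gu ≡ gu
  unit-fixed = init-last-injective
    (trans (init-⊕id (apply N) gu) (trans (cong (apply N) (Vec.init-∷ʳ 1ℚ 0v))
      (trans (additive-0v (apply′-additive N)) (sym (Vec.init-∷ʳ 1ℚ 0v)))))
    (last-⊕id (apply N) gu)

additive-iso⇒≅ₙ : ∀ {m} {G H : RQ m} {Φ Ψ : V m → V m} → Additive Φ → Additive Ψ →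
                  (∀ v → Ψ (Φ v) ≡ v) → (∀ v → Φ (Ψ v) ≡ v) →
                  (∀ x → carrier G x → carrier H (Φ x)) → (∀ y → carrier H y → carrier G (Ψ y)) → G ≅ₙ H
additive-iso⇒≅ₙ {G = G} {H} {Φ} {Ψ} Φ-additive Ψ-additive ΨΦ ΦΨ Φ-maps Ψ-maps =
  matrixOf Ψ , (matrixOf Φ , MN , NM) , λ x → (λ p → Φ x , Φ-maps x p , trans (M≗Ψ (Φ x)) (ΨΦ x)) , from-image x
  where
  M≗Ψ : ∀ v → apply (matrixOf Ψ) v ≡ Ψ v
  M≗Ψ = apply′-matrixOf Ψ-additive
  N≗Φ : ∀ v → apply (matrixOf Φ) v ≡ Φ v
  N≗Φ = apply′-matrixOf Φ-additive
  MN : ∀ v → apply (matrixOf Ψ) (apply (matrixOf Φ) v) ≡ v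
  MN v = trans (M≗Ψ _) (trans (cong Ψ (N≗Φ v)) (ΨΦ v))
  NM : ∀ v → apply (matrixOf Φ) (apply (matrixOf Ψ) v) ≡ v
  NM v = trans (N≗Φ _) (trans (cong Φ (M≗Ψ v)) (ΦΨ v))
  from-image : ∀ x → ∃[ y ] (carrier H y × apply (matrixOf Ψ) y ≡ x) → carrier G x
  from-image x (y , q , My≡x) = subst (carrier G) (trans (sym (M≗Ψ y)) My≡x) (Ψ-maps y q)

module Restriction {m} {G H : RQ m} (f : Elt (gA G) → Elt (gA H))
                   (f-additive : AdditiveOn (gA G) (proj₁ ∘ f))
                   (f-positive : ∀ a → gA⁺ G (proj₁ a) ⇔ gA⁺ H (proj₁ (f a))) where
  private
    module DG = DimensionGroup G
  open AdditiveOn DG.A-subgroup f-additive public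

  f-kernel : ∀ a → proj₁ (f a) ≡ 0v → proj₁ a ≡ 0v
  f-kernel (x , p) fx≡0 = DG.A⁺-anti x
    (proj₂ (f-positive (x , p)) (inj₂ fx≡0))
    (proj₂ (f-positive (negv x , DG.A.closed- x p)) (inj₂ (trans (φ-negv x p _) (trans (cong negv fx≡0) +v.ε⁻¹≈ε))))

  f-injective : ∀ a b → proj₁ (f a) ≡ proj₁ (f b) → proj₁ a ≡ proj₁ b
  f-injective (x , p) (y , q) fx≡fy = +v.x∙y⁻¹≈ε⇒x≈y x y (f-kernel (x -v y , DG.A.closed-sub x y p q) (begin
    proj₁ (f (x -v y , DG.A.closed-sub x y p q))           ≡⟨ f-additive x (negv y) p (DG.A.closed- y q) _ ⟩
    proj₁ (f (x , p)) +v proj₁ (f (negv y , _))         ≡⟨ cong (proj₁ (f (x , p)) +v_) (φ-negv y q _) ⟩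
    proj₁ (f (x , p)) -v proj₁ (f (y , q))              ≡⟨ +v.x≈y⇒x∙y⁻¹≈ε fx≡fy ⟩
    0v                                                  ∎))
    where open ≡-Reasoning

  -- f a positive with last a = 0 would force a ∈ A⁺, hence a = 0 and f a = 0
  last-zero-not-positive : ∀ a → last (proj₁ a) ≡ 0ℚ → ¬ (0ℚ < last (proj₁ (f a)))
  last-zero-not-positive (x , p) x₀≡0 0<fx₀ = QP.<-irrefl (sym fx₀≡0) 0<fx₀
    where
    x≡0 : x ≡ 0v
    x≡0 = DG.A⁺-last-zero (proj₂ (f-positive (x , p)) (inj₁ (proj₂ (f (x , p)) , 0<fx₀))) x₀≡0
    fx₀≡0 : last (proj₁ (f (x , p))) ≡ 0ℚ
    fx₀≡0 = trans (cong last (trans (cong-φ x≡0 p DG.A.has-0) (φ-0v _))) (last-replicate m 0ℚ)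

  f-last-zero : ∀ a → last (proj₁ a) ≡ 0ℚ → last (proj₁ (f a)) ≡ 0ℚ
  f-last-zero a@(x , p) x₀≡0 with QP.<-cmp 0ℚ (last (proj₁ (f a)))
  ... | tri≈ _ 0≡fx₀ _ = sym 0≡fx₀
  ... | tri< 0<fx₀ _ _ = ⊥-elim (last-zero-not-positive a x₀≡0 0<fx₀)
  ... | tri> _ _ fx₀<0 = ⊥-elim (last-zero-not-positive (negv x , DG.A.closed- x p) -x₀≡0 0<f-x₀)
    where
    -x₀≡0 : last (negv x) ≡ 0ℚ
    -x₀≡0 = trans (last-negv x) (trans (cong (λ q → Q.- q) x₀≡0) ℚ+.ε⁻¹≈ε)
    0<f-x₀ : 0ℚ < last (proj₁ (f (negv x , DG.A.closed- x p)))
    0<f-x₀ = subst₂ _<_ ℚ+.ε⁻¹≈ε (sym (trans (cong last (φ-negv x p _)) (last-negv (proj₁ (f a))))) (QP.neg-antimono-< fx₀<0)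

  embed : Elt (carrier G) → Elt (gA G)
  embed (y , p) = y ∷ʳ 0ℚ , subst (carrier G) (sym (Vec.init-∷ʳ 0ℚ y)) p

  restriction : Elt (carrier G) → V m
  restriction b = init (proj₁ (f (embed b)))

  restriction-maps : ∀ b → carrier H (restriction b)
  restriction-maps b = proj₂ (f (embed b))

  f-embed : ∀ b → proj₁ (f (embed b)) ≡ restriction b ∷ʳ 0ℚ
  f-embed b@(y , _) = trans (sym (∷ʳ-init-last _)) (cong (restriction b ∷ʳ_) (f-last-zero (embed b) (Vec.last-∷ʳ 0ℚ y)))

  restriction-additive : AdditiveOn (carrier G) restriction
  restriction-additive x y p q pxy = begin
    init (proj₁ (f (embed (x +v y , pxy))))                                ≡⟨ cong init (cong-φ ∷ʳ0-+v _ x0+y0∈A) ⟩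
    init (proj₁ (f ((x ∷ʳ 0ℚ) +v (y ∷ʳ 0ℚ) , x0+y0∈A)))                    ≡⟨ cong init (f-additive _ _ _ _ x0+y0∈A) ⟩
    init (proj₁ (f (embed (x , p))) +v proj₁ (f (embed (y , q))))         ≡⟨ init-additive _ _ ⟩
    restriction (x , p) +v restriction (y , q)                            ∎
    where
    open ≡-Reasoning
    x0+y0∈A = DG.A.closed+ _ _ (proj₂ (embed (x , p))) (proj₂ (embed (y , q)))
    ∷ʳ0-+v : (x +v y) ∷ʳ 0ℚ ≡ (x ∷ʳ 0ℚ) +v (y ∷ʳ 0ℚ)
    ∷ʳ0-+v = init-last-injective
      (trans (Vec.init-∷ʳ 0ℚ (x +v y)) (sym (trans (init-additive (x ∷ʳ 0ℚ) (y ∷ʳ 0ℚ))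
        (cong₂ _+v_ (Vec.init-∷ʳ 0ℚ x) (Vec.init-∷ʳ 0ℚ y)))))
      (trans (Vec.last-∷ʳ 0ℚ (x +v y)) (sym (trans (last-+v (x ∷ʳ 0ℚ) (y ∷ʳ 0ℚ))
        (trans (cong₂ Q._+_ (Vec.last-∷ʳ 0ℚ x) (Vec.last-∷ʳ 0ℚ y)) (QP.+-identityʳ 0ℚ)))))

module OrderIso {m} {G H : RQ m} (f : Elt (gA G) → Elt (gA H)) (g : Elt (gA H) → Elt (gA G))
                (gf : ∀ a → proj₁ (g (f a)) ≡ proj₁ a) (fg : ∀ b → proj₁ (f (g b)) ≡ proj₁ b)
                (f-additive : AdditiveOn (gA G) (proj₁ ∘ f))
                (f-positive : ∀ a → gA⁺ G (proj₁ a) ⇔ gA⁺ H (proj₁ (f a))) where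
  private
    module DG = DimensionGroup G

  module F = Restriction {G = G} {H} f f-additive f-positive

  g-additive : AdditiveOn (gA H) (proj₁ ∘ g)
  g-additive x y p q pxy = F.f-injective (g (x +v y , pxy)) (_ , gx+gy∈A) (begin
    proj₁ (f (g (x +v y , pxy)))                 ≡⟨ fg _ ⟩
    x +v y                                       ≡⟨ sym (cong₂ _+v_ (fg (x , p)) (fg (y , q))) ⟩
    proj₁ (f (g (x , p))) +v proj₁ (f (g (y , q)))  ≡⟨ sym (f-additive _ _ _ _ gx+gy∈A) ⟩
    proj₁ (f (_ , gx+gy∈A))                      ∎)
    where
    open ≡-Reasoning
    gx+gy∈A = DG.A.closed+ _ _ (proj₂ (g (x , p))) (proj₂ (g (y , q)))

  g-positive : ∀ b → gA⁺ H (proj₁ b) ⇔ gA⁺ G (proj₁ (g b))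
  g-positive b = (λ b⁺ → proj₂ (f-positive (g b)) (subst (gA⁺ H) (sym (fg b)) b⁺))
               , (λ gb⁺ → subst (gA⁺ H) (fg b) (proj₁ (f-positive (g b)) gb⁺))

  module F′ = Restriction {G = H} {G} g g-additive g-positive

  restriction-inverse : ∀ y p q → F′.restriction (F.restriction (y , p) , q) ≡ y
  restriction-inverse y p q = begin
    init (proj₁ (g (F′.embed (F.restriction (y , p) , q))))  ≡⟨ cong init (F′.cong-φ (sym (F.f-embed (y , p))) _ _) ⟩
    init (proj₁ (g (f (F.embed (y , p)))))                  ≡⟨ cong init (gf (F.embed (y , p))) ⟩
    init (y ∷ʳ 0ℚ)                                          ≡⟨ Vec.init-∷ʳ 0ℚ y ⟩
    y                                                       ∎
    where open ≡-Reasoning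

≅⁺⇒≅ₙ : ∀ {m} {G H : RQ m} → gmap G ≅⁺ gmap H → G ≅ₙ H
≅⁺⇒≅ₙ {m} {G} {H} (f , g , gf , fg , f-additive , f-positive , _) =
  additive-iso⇒≅ₙ {G = G} {H} Φ.extension-additive Ψ.extension-additive ΨΦ ΦΨ Φ-maps Ψ-maps
  where
  module fg = OrderIso {G = G} {H} f g gf fg f-additive f-positive
  module gf = OrderIso {G = H} {G} g f fg gf fg.g-additive fg.g-positive
  module Φ = LinearExtension (isSubgroup G) (fullRank G) fg.F.restriction-additive
  module Ψ = LinearExtension (isSubgroup H) (fullRank H) gf.F.restriction-additive

  Φ-maps : ∀ x → carrier G x → carrier H (Φ.extension x)
  Φ-maps x p = subst (carrier H) (sym (Φ.extension-extends x p)) (fg.F.restriction-maps (x , p))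

  Ψ-maps : ∀ y → carrier H y → carrier G (Ψ.extension y)
  Ψ-maps y q = subst (carrier G) (sym (Ψ.extension-extends y q)) (gf.F.restriction-maps (y , q))

  ΨΦ : ∀ v → Ψ.extension (Φ.extension v) ≡ v
  ΨΦ = additive-unique (fullRank G) (additive-∘ Ψ.extension-additive Φ.extension-additive) (λ _ _ → refl)
    λ x p → trans (cong Ψ.extension (Φ.extension-extends x p))
              (trans (Ψ.extension-extends _ (fg.F.restriction-maps (x , p))) (fg.restriction-inverse x p _))

  ΦΨ : ∀ v → Φ.extension (Ψ.extension v) ≡ v
  ΦΨ = additive-unique (fullRank H) (additive-∘ Φ.extension-additive Ψ.extension-additive) (λ _ _ → refl)
    λ y q → trans (cong Φ.extension (Ψ.extension-extends y q))
              (trans (Φ.extension-extends _ (gf.F.restriction-maps (y , q))) (gf.restriction-inverse y q _))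

mainTheorem6 : (n : ℕ) → IsBorelReduction (gmap {suc n})
mainTheorem6 n = DimensionGroup.isSDG , gmap-borel , λ G H → ≅ₙ⇒≅⁺ {G = G} {H} , ≅⁺⇒≅ₙ {G = G} {H}
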